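{- Let $\mathbf{\Omega}$ be a chain, $a\in\Omega$ and $f\in F(\mathbf{\Omega})$ with $|f^{ -1}[a]|>1$. Then $f^{\ell}(a)\notin\Omega^{ - }$, $f^{r}(a)\notin\Omega^{+}$ and $a\notin\Omega^{ - }\cup\Omega^{+}$.
   Context: $f^{r}$ is the residual of $f$ ($f(a)\le b\iff a\le f^{r}(b)$) and $f^{\ell}$ its dual residual ($f^{\ell}(a)\le b\iff a\le f(b)$). $F(\mathbf{\Omega})$ is the set of order-preserving maps on $\Omega$ having residuals and dual residuals of all orders. $\Omega^{ - }=\{a: a=\bigvee\{b:b<a\}\}$ and $\Omega^{+}=\{a: a=\bigwedge\{b:a<b\}\}$. $f^{ -1}[a]$ is the preimage of $\{a\}$. -}

module Defs where

open import Level using (Level; _⊔_)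
open import Data.Product using (Σ; _×_; ∃; ∃-syntax)
open import Data.Integer using (ℤ; suc)
open import Relation.Nullary using (¬_)
open import Relation.Binary.Bundles using (TotalOrder)

module ChainDefs {c ℓ₁ ℓ₂ : Level} (Ω : TotalOrder c ℓ₁ ℓ₂) where
  open TotalOrder Ω renaming (Carrier to C)

  _<_ : C → C → Set (ℓ₁ ⊔ ℓ₂)
  a < b = (a ≤ b) × ¬ (a ≈ b)

  IsJoin : (C → Set (ℓ₁ ⊔ ℓ₂)) → C → Set (c ⊔ ℓ₁ ⊔ ℓ₂)
  IsJoin S s = (∀ b → S b → b ≤ s) × (∀ u → (∀ b → S b → b ≤ u) → s ≤ u)

  IsMeet : (C → Set (ℓ₁ ⊔ ℓ₂)) → C → Set (c ⊔ ℓ₁ ⊔ ℓ₂)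
  IsMeet S s = (∀ b → S b → s ≤ b) × (∀ u → (∀ b → S b → u ≤ b) → u ≤ s)

  Ω⁻ : C → Set (c ⊔ ℓ₁ ⊔ ℓ₂)
  Ω⁻ a = IsJoin (λ b → b < a) a

  Ω⁺ : C → Set (c ⊔ ℓ₁ ⊔ ℓ₂)
  Ω⁺ a = IsMeet (λ b → a < b) a

  OrderPreserving : (C → C) → Set (c ⊔ ℓ₂)
  OrderPreserving f = ∀ {x y} → x ≤ y → f x ≤ f y

  -- g is the residual of f :  f a ≤ b  ⇔  a ≤ g b
  -- (equivalently f is the dual residual of g)
  IsResidual : (C → C) → (C → C) → Set (c ⊔ ℓ₂)
  IsResidual f g = ∀ a b → (f a ≤ b → a ≤ g b) × (a ≤ g b → f a ≤ b)

  -- F(Ω): order-preserving maps having residuals and dual residuals of all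
  -- orders, i.e. there is a ℤ-indexed chain of maps g with g 0 = f and
  -- g (n+1) the residual of g n (so g (n-1) is the dual residual of g n).
  InF : (C → C) → Set (c ⊔ ℓ₁ ⊔ ℓ₂)
  InF f = OrderPreserving f ×
          (Σ (ℤ → C → C) λ g → (∀ x → g (ℤ.pos 0) x ≈ f x)
                             × (∀ n → IsResidual (g n) (g (suc n))))

  FibreHasTwo : (C → C) → C → Set (c ⊔ ℓ₁)
  FibreHasTwo f a = ∃[ x ] ∃[ y ] (f x ≈ a) × (f y ≈ a) × ¬ (x ≈ y)

-- Every point of the fibre f⁻¹[a] lies in the interval [fˡ a, fʳ a], so two
-- distinct points force fʳ a ≰ fˡ a.  On a chain, b < a implies fʳ b ≤ fˡ a
-- (otherwise a ≤ f (fˡ a) ≤ f (fʳ b) ≤ b).  Since f ∈ F(Ω), fʳ is a lower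
-- adjoint and so preserves joins; if a = ⋁{b : b < a} this yields fʳ a ≤ fˡ a.
-- Dually fˡ is an upper adjoint preserving meets, which excludes a ∈ Ω⁺.
-- Finally f (fˡ a) ≈ a, so the join-preserving f maps {b : b < fˡ a} into
-- {c : c < a} and fˡ a ∈ Ω⁻ gives a ∈ Ω⁻; dually fʳ a ∈ Ω⁺ gives a ∈ Ω⁺.
module Submission where

open import Defs
open import Level using (Level)
open import Data.Product using (_×_; _,_; ∃; proj₁; proj₂)
open import Data.Sum using (_⊎_; inj₁; inj₂)
open import Data.Integer using (+_; -[1+_])
open import Relation.Nullary using (¬_; contradiction)
open import Relation.Binary.Bundles using (TotalOrder)

module Chain {c ℓ₁ ℓ₂ : Level} (Ω : TotalOrder c ℓ₁ ℓ₂) where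
  open TotalOrder Ω renaming (Carrier to C)
  open ChainDefs Ω

  module Residuation {f g : C → C} (f⊣g : IsResidual f g) where

    to : ∀ {a b} → f a ≤ b → a ≤ g b
    to = proj₁ (f⊣g _ _)

    from : ∀ {a b} → a ≤ g b → f a ≤ b
    from = proj₂ (f⊣g _ _)

    unit : ∀ a → a ≤ g (f a)
    unit _ = to refl

    counit : ∀ b → f (g b) ≤ b
    counit _ = from refl

    f-mono : OrderPreserving f
    f-mono a≤b = from (trans a≤b (unit _))

    join-least : ∀ {S s u} → IsJoin S s → (∀ b → S b → f b ≤ u) → f s ≤ u
    join-least (_ , least) fS≤u = from (least _ λ b b∈S → to (fS≤u b b∈S))

    meet-greatest : ∀ {S s u} → IsMeet S s → (∀ b → S b → u ≤ g b) → u ≤ g s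
    meet-greatest (_ , greatest) u≤gS = to (greatest _ λ b b∈S → from (u≤gS b b∈S))

  open Residuation using (to; from; unit; counit; f-mono)

  IsResidual-cong : ∀ {f f′ g g′} → (∀ x → f x ≈ f′ x) → (∀ x → g x ≈ g′ x) →
                    IsResidual f g → IsResidual f′ g′
  IsResidual-cong f≈f′ g≈g′ f⊣g a b =
    (λ f′a≤b → ≤-respʳ-≈ (g≈g′ b) (to f⊣g (≤-respˡ-≈ (Eq.sym (f≈f′ a)) f′a≤b))) ,
    (λ a≤g′b → ≤-respˡ-≈ (f≈f′ a) (from f⊣g (≤-respʳ-≈ (Eq.sym (g≈g′ b)) a≤g′b)))

  residual-unique : ∀ {f g h} → IsResidual f g → IsResidual f h → ∀ b → g b ≈ h b
  residual-unique f⊣g f⊣h b = antisym (to f⊣h (counit f⊣g b)) (to f⊣g (counit f⊣h b))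

  dualResidual-unique : ∀ {f g h} → IsResidual f h → IsResidual g h → ∀ a → f a ≈ g a
  dualResidual-unique f⊣h g⊣h a = antisym (from f⊣h (unit g⊣h a)) (from g⊣h (unit f⊣h a))

  InF⇒residual-residuated : ∀ {f fʳ} → InF f → IsResidual f fʳ → ∃ (IsResidual fʳ)
  InF⇒residual-residuated (_ , g , g₀≈f , g⊣g) f⊣fʳ =
    g (+ 2) , IsResidual-cong g₁≈fʳ (λ _ → Eq.refl) (g⊣g (+ 1))
    where
    g₁≈fʳ : ∀ x → g (+ 1) x ≈ _
    g₁≈fʳ = residual-unique (IsResidual-cong g₀≈f (λ _ → Eq.refl) (g⊣g (+ 0))) f⊣fʳ

  InF⇒dualResidual-dualResiduated : ∀ {f fˡ} → InF f → IsResidual fˡ f →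
                                    ∃ λ h → IsResidual h fˡ
  InF⇒dualResidual-dualResiduated (_ , g , g₀≈f , g⊣g) fˡ⊣f =
    g -[1+ 1 ] , IsResidual-cong (λ _ → Eq.refl) g₋₁≈fˡ (g⊣g -[1+ 1 ])
    where
    g₋₁≈fˡ : ∀ x → g -[1+ 0 ] x ≈ _
    g₋₁≈fˡ = dualResidual-unique (IsResidual-cong (λ _ → Eq.refl) g₀≈f (g⊣g -[1+ 0 ])) fˡ⊣f

  module _ {f fʳ fˡ : C → C} (f⊣fʳ : IsResidual f fʳ) (fˡ⊣f : IsResidual fˡ f) where

    fibre-between : ∀ {a x} → f x ≈ a → fˡ a ≤ x × x ≤ fʳ a
    fibre-between fx≈a = from fˡ⊣f (reflexive (Eq.sym fx≈a)) , to f⊣fʳ (reflexive fx≈a)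

    FibreHasTwo⇒residual≰dualResidual : ∀ {a} → FibreHasTwo f a → ¬ (fʳ a ≤ fˡ a)
    FibreHasTwo⇒residual≰dualResidual (x , y , fx≈a , fy≈a , x≉y) fʳa≤fˡa =
      x≉y (Eq.trans (squeeze fx≈a) (Eq.sym (squeeze fy≈a)))
      where
      squeeze : ∀ {z} → f z ≈ _ → z ≈ fˡ _
      squeeze fz≈a with fibre-between fz≈a
      ... | fˡa≤z , z≤fʳa = antisym (trans z≤fʳa fʳa≤fˡa) fˡa≤z

    dualResidual≤residual⇒≤ : ∀ {a b} → fˡ a ≤ fʳ b → a ≤ b
    dualResidual≤residual⇒≤ fˡa≤fʳb =
      trans (unit fˡ⊣f _) (trans (f-mono f⊣fʳ fˡa≤fʳb) (counit f⊣fʳ _))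

    <⇒residual≤dualResidual : ∀ {a b} → b < a → fʳ b ≤ fˡ a
    <⇒residual≤dualResidual (b≤a , b≉a) with total (fʳ _) (fˡ _)
    ... | inj₁ fʳb≤fˡa = fʳb≤fˡa
    ... | inj₂ fˡa≤fʳb = contradiction (antisym b≤a (dualResidual≤residual⇒≤ fˡa≤fʳb)) b≉a

    Ω⁻⇒residual≤dualResidual : ∀ {a h} → IsResidual fʳ h → Ω⁻ a → fʳ a ≤ fˡ a
    Ω⁻⇒residual≤dualResidual fʳ⊣h a∈Ω⁻ =
      Residuation.join-least fʳ⊣h a∈Ω⁻ λ _ → <⇒residual≤dualResidual

    Ω⁺⇒residual≤dualResidual : ∀ {a h} → IsResidual h fˡ → Ω⁺ a → fʳ a ≤ fˡ a
    Ω⁺⇒residual≤dualResidual h⊣fˡ a∈Ω⁺ =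
      Residuation.meet-greatest h⊣fˡ a∈Ω⁺ λ _ → <⇒residual≤dualResidual

    Ω⁻-dualResidual⇒Ω⁻ : ∀ {a} → f (fˡ a) ≤ a → Ω⁻ (fˡ a) → Ω⁻ a
    Ω⁻-dualResidual⇒Ω⁻ {a} ffˡa≤a (_ , least) =
      (λ _ b<a → proj₁ b<a) ,
      λ u ub → trans (unit fˡ⊣f a) (from f⊣fʳ (least _ λ b b<fˡa → to f⊣fʳ (ub _ (f<a b<fˡa))))
      where
      f<a : ∀ {b} → b < fˡ a → f b < a
      f<a (b≤fˡa , b≉fˡa) =
        trans (f-mono f⊣fʳ b≤fˡa) ffˡa≤a ,
        λ fb≈a → b≉fˡa (antisym b≤fˡa (from fˡ⊣f (reflexive (Eq.sym fb≈a))))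

    Ω⁺-residual⇒Ω⁺ : ∀ {a} → a ≤ f (fʳ a) → Ω⁺ (fʳ a) → Ω⁺ a
    Ω⁺-residual⇒Ω⁺ {a} a≤ffʳa (_ , greatest) =
      (λ _ a<b → proj₁ a<b) ,
      λ u lb → trans (to fˡ⊣f (greatest _ λ b fʳa<b → from fˡ⊣f (lb _ (a<f fʳa<b)))) (counit f⊣fʳ a)
      where
      a<f : ∀ {b} → fʳ a < b → a < f b
      a<f (fʳa≤b , fʳa≉b) =
        trans a≤ffʳa (f-mono f⊣fʳ fʳa≤b) ,
        λ a≈fb → fʳa≉b (antisym fʳa≤b (to f⊣fʳ (reflexive (Eq.sym a≈fb))))

lemma2p6 : {c ℓ₁ ℓ₂ : Level} (Ω : TotalOrder c ℓ₁ ℓ₂) →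
    let open TotalOrder Ω renaming (Carrier to C) in
    let open ChainDefs Ω in
    (a : C) (f fʳ fˡ : C → C) →
    InF f → IsResidual f fʳ → IsResidual fˡ f →
    FibreHasTwo f a →
    (¬ Ω⁻ (fˡ a)) × (¬ Ω⁺ (fʳ a)) × (¬ (Ω⁻ a ⊎ Ω⁺ a))
lemma2p6 Ω a f fʳ fˡ f∈F f⊣fʳ fˡ⊣f two@(x , _ , fx≈a , _) =
  (λ fˡa∈Ω⁻ → ¬Ω⁻ (Ω⁻-dualResidual⇒Ω⁻ f⊣fʳ fˡ⊣f ffˡa≤a fˡa∈Ω⁻)) ,
  (λ fʳa∈Ω⁺ → ¬Ω⁺ (Ω⁺-residual⇒Ω⁺ f⊣fʳ fˡ⊣f a≤ffʳa fʳa∈Ω⁺)) ,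
  λ { (inj₁ a∈Ω⁻) → ¬Ω⁻ a∈Ω⁻ ; (inj₂ a∈Ω⁺) → ¬Ω⁺ a∈Ω⁺ }
  where
  open TotalOrder Ω
  open ChainDefs Ω using (Ω⁻; Ω⁺)
  open Chain Ω
  open Residuation using (f-mono)

  gap : ¬ (fʳ a ≤ fˡ a)
  gap = FibreHasTwo⇒residual≰dualResidual f⊣fʳ fˡ⊣f two

  ¬Ω⁻ : ¬ Ω⁻ a
  ¬Ω⁻ a∈Ω⁻ with InF⇒residual-residuated f∈F f⊣fʳ
  ... | _ , fʳ⊣h = gap (Ω⁻⇒residual≤dualResidual f⊣fʳ fˡ⊣f fʳ⊣h a∈Ω⁻)

  ¬Ω⁺ : ¬ Ω⁺ a
  ¬Ω⁺ a∈Ω⁺ with InF⇒dualResidual-dualResiduated f∈F fˡ⊣f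
  ... | _ , h⊣fˡ = gap (Ω⁺⇒residual≤dualResidual f⊣fʳ fˡ⊣f h⊣fˡ a∈Ω⁺)

  x-between : fˡ a ≤ x × x ≤ fʳ a
  x-between = fibre-between f⊣fʳ fˡ⊣f fx≈a

  ffˡa≤a : f (fˡ a) ≤ a
  ffˡa≤a = trans (f-mono f⊣fʳ (proj₁ x-between)) (reflexive fx≈a)

  a≤ffʳa : a ≤ f (fʳ a)
  a≤ffʳa = trans (reflexive (Eq.sym fx≈a)) (f-mono f⊣fʳ (proj₂ x-between))
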